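{- Let $G$ be a connected graph of order $n \geq 4$ with $\gamma_R(G) = 3$. Then $b_R(G) = \Delta(G) = n - 2$ if and only if $G \cong C_4$.
   Context: All graphs are finite and simple; $C_4$ is the cycle on four vertices. A Roman dominating function on $G$ is a function $f: V(G) \to \{0,1,2\}$ such that every vertex $v$ with $f(v)=0$ has a neighbor $u$ with $f(u)=2$; its weight is $\sum_v f(v)$, and $\gamma_R(G)$ is the minimum weight of such a function. $\Delta(G)$ is the maximum degree. For a graph with maximum degree at least two, the Roman bondage number $b_R(G)$ is the minimum cardinality of a set $E' \subseteq E(G)$ with $\gamma_R(G - E') > \gamma_R(G)$, where $G-E'$ is obtained by deleting the edges of $E'$. -}

module Defs where

open import Data.Nat using (ℕ; zero; suc; _+_; _≤_; _<_; _<ᵇ_)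
open import Data.Fin using (Fin; zero; suc; toℕ)
open import Data.Bool using (Bool; true; false; _∧_; not; if_then_else_)
open import Data.Product using (Σ; ∃; _×_; _,_)
open import Relation.Binary.PropositionalEquality using (_≡_; refl)
open import Function.Bundles using (_↔_; Inverse)

record Graph (n : ℕ) : Set where
  field
    adj    : Fin n → Fin n → Bool
    sym    : ∀ i j → adj i j ≡ adj j i
    irrefl : ∀ i → adj i i ≡ false
open Graph public

count : ∀ {n} → (Fin n → Bool) → ℕ
count {zero}  p = 0
count {suc n} p = (if p zero then 1 else 0) + count (λ i → p (suc i))

sumFin : ∀ {n} → (Fin n → ℕ) → ℕ
sumFin {zero}  f = 0
sumFin {suc n} f = f zero + sumFin (λ i → f (suc i))

deg : ∀ {n} → Graph n → Fin n → ℕ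
deg G v = count (adj G v)

MaxDegree : ∀ {n} → Graph n → ℕ → Set
MaxDegree G d = (∃ λ v → deg G v ≡ d) × (∀ v → deg G v ≤ d)

data Reach {n} (G : Graph n) : Fin n → Fin n → Set where
  here : ∀ {u} → Reach G u u
  step : ∀ {u v w} → adj G u v ≡ true → Reach G v w → Reach G u w

Connected : ∀ {n} → Graph n → Set
Connected {n} G = ∀ (u v : Fin n) → Reach G u v

IsRDF : ∀ {n} → Graph n → (Fin n → Fin 3) → Set
IsRDF {n} G f = ∀ v → toℕ (f v) ≡ 0 →
  ∃ λ (u : Fin n) → (adj G v u ≡ true) × (toℕ (f u) ≡ 2)

weight : ∀ {n} → (Fin n → Fin 3) → ℕ
weight f = sumFin (λ v → toℕ (f v))

RomanDomNumber : ∀ {n} → Graph n → ℕ → Set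
RomanDomNumber G k =
  (∃ λ f → IsRDF G f × weight f ≡ k) × (∀ f → IsRDF G f → k ≤ weight f)

record EdgeSubset {n} (G : Graph n) : Set where
  field
    del    : Fin n → Fin n → Bool
    delSym : ∀ i j → del i j ≡ del j i
    delSub : ∀ i j → del i j ≡ true → adj G i j ≡ true
open EdgeSubset public

edgeCount : ∀ {n} {G : Graph n} → EdgeSubset G → ℕ
edgeCount E = sumFin (λ i → count (λ j → del E i j ∧ (toℕ i <ᵇ toℕ j)))

private
  ∧-false : ∀ b → (false ∧ b) ≡ false
  ∧-false b = refl

deleteEdges : ∀ {n} (G : Graph n) → EdgeSubset G → Graph n
deleteEdges G E = record
  { adj    = λ i j → adj G i j ∧ not (del E i j)
  ; sym    = symP
  ; irrefl = irr
  }
  where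
  symP : ∀ i j → (adj G i j ∧ not (del E i j)) ≡ (adj G j i ∧ not (del E j i))
  symP i j rewrite Graph.sym G i j | delSym E i j = refl
  irr : ∀ i → (adj G i i ∧ not (del E i i)) ≡ false
  irr i rewrite Graph.irrefl G i = refl

RomanBondage : ∀ {n} → Graph n → ℕ → Set
RomanBondage G b =
  (∃ λ (E : EdgeSubset G) → edgeCount E ≡ b × Increases E)
  × (∀ (E : EdgeSubset G) → Increases E → b ≤ edgeCount E)
  where
  Increases : EdgeSubset G → Set
  Increases E = ∃ λ g → ∃ λ g' →
    RomanDomNumber G g × RomanDomNumber (deleteEdges G E) g' × g < g'

-- the 4-cycle 0 - 1 - 2 - 3 - 0
c4adj : Fin 4 → Fin 4 → Bool
c4adj zero (suc zero) = true
c4adj zero (suc (suc (suc zero))) = true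
c4adj (suc zero) zero = true
c4adj (suc zero) (suc (suc zero)) = true
c4adj (suc (suc zero)) (suc zero) = true
c4adj (suc (suc zero)) (suc (suc (suc zero))) = true
c4adj (suc (suc (suc zero))) (suc (suc zero)) = true
c4adj (suc (suc (suc zero))) zero = true
c4adj _ _ = false

C4 : Graph 4
C4 = record { adj = c4adj ; sym = s ; irrefl = r }
  where
  s : ∀ i j → c4adj i j ≡ c4adj j i
  s zero zero = refl
  s zero (suc zero) = refl
  s zero (suc (suc zero)) = refl
  s zero (suc (suc (suc zero))) = refl
  s (suc zero) zero = refl
  s (suc zero) (suc zero) = refl
  s (suc zero) (suc (suc zero)) = refl
  s (suc zero) (suc (suc (suc zero))) = refl
  s (suc (suc zero)) zero = refl
  s (suc (suc zero)) (suc zero) = refl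
  s (suc (suc zero)) (suc (suc zero)) = refl
  s (suc (suc zero)) (suc (suc (suc zero))) = refl
  s (suc (suc (suc zero))) zero = refl
  s (suc (suc (suc zero))) (suc zero) = refl
  s (suc (suc (suc zero))) (suc (suc zero)) = refl
  s (suc (suc (suc zero))) (suc (suc (suc zero))) = refl
  r : ∀ i → c4adj i i ≡ false
  r zero = refl
  r (suc zero) = refl
  r (suc (suc zero)) = refl
  r (suc (suc (suc zero))) = refl

_≅_ : ∀ {n m} → Graph n → Graph m → Set
_≅_ {n} {m} G H = Σ (Fin n ↔ Fin m) λ σ →
  ∀ i j → adj G i j ≡ adj H (Inverse.to σ i) (Inverse.to σ j)

-- If γ_R(G) = 3, the function putting 2 on a vertex u, 0 on its neighbours and 1
-- elsewhere (weight n + 1 − deg u) shows that every degree is at most n − 2, while for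
-- n ≥ 4 a graph whose degrees are all at most n − 3 has γ_R ≥ 4. Hence Δ(G) = n − 2,
-- and deleting edges raises γ_R exactly when every near-universal vertex (one of
-- degree n − 2, i.e. with a single non-neighbour) loses an edge: b_R(G) is the least
-- number of edges meeting all near-universal vertices. For n ≥ 5 the star at a
-- near-universal vertex v reaches every vertex except its non-neighbour w; dropping
-- star edges to vertices that need no cover, or to two vertices that can share one
-- edge instead, brings it down to n − 3 edges. This fails only if every vertex is
-- near-universal and n = 5, impossible since the degree sum 15 would be odd. For n = 4
-- a connected graph with Δ = 2 is a path, where one edge suffices, or C₄, where two
-- are needed.
module Submission where

open import Defs hiding (sym)
open import Data.Bool using (Bool; true; false; _∧_; _∨_; not; if_then_else_)
open import Data.Bool.Properties using (∧-identityʳ; ∧-zeroʳ; ∨-comm; ∨-zeroʳ; not-injective; not-involutive)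
open import Data.Empty using (⊥; ⊥-elim)
open import Data.Fin using (Fin; zero; suc; toℕ; finToFun; funToFin)
open import Data.Fin.Patterns using (0F; 1F; 2F; 3F)
open import Data.Fin.Permutation using (↔⇒≡)
open import Data.Fin.Properties using (toℕ-injective; any?; all?; ¬∀⟶∃¬; injective⇒≤; finToFun-funToFin)
open import Data.List using (List; []; _∷_; length; lookup)
open import Data.List.Membership.Propositional using (_∈_; _∉_)
open import Data.List.Membership.Propositional.Properties using (∈-lookup)
open import Data.List.Relation.Unary.All as All using (All; []; _∷_)
open import Data.List.Relation.Unary.All.Properties using (¬Any⇒All¬; All¬⇒¬Any)
open import Data.List.Relation.Unary.Any as Any using (here; there; index)
open import Data.List.Relation.Unary.Any.Properties using (lookup-index)
open import Data.List.Relation.Unary.Unique.Propositional using (Unique; []; _∷_)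
open import Data.Nat using (ℕ; zero; suc; _+_; _*_; _∸_; _≤_; _<_; _<ᵇ_; z≤n; s≤s)
open import Data.Nat.Induction using (<-rec)
open import Data.Nat.Properties
open import Algebra.Properties.CommutativeSemigroup +-commutativeSemigroup using (interchange; x∙yz≈y∙xz)
open import Data.Product using (∃; _×_; _,_; proj₁; proj₂)
open import Data.Sum using (_⊎_; inj₁; inj₂)
open import Function using (_∘_; _↔_; _⇔_; mk⇔; mk↔ₛ′; Inverse)
open import Level using (0ℓ)
open import Relation.Binary.PropositionalEquality
open import Relation.Nullary using (¬_; Dec; yes; no; ¬?; does)
open import Relation.Nullary.Decidable using (map′; _×-dec_; _→-dec_; decidable-stable; dec-true; dec-false)
open import Relation.Unary using (Pred; _⊆_; _∪_)
import Data.Bool as Bool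
import Data.Fin as Fin
import Data.List.Membership.Setoid.Properties as MembershipProperties
import Data.Nat as Nat

variable
  n : ℕ

-- Counting over Fin n

_==_ : Fin n → Fin n → Bool
zero  == zero  = true
zero  == suc _ = false
suc _ == zero  = false
suc x == suc y = x == y

==-refl : (x : Fin n) → (x == x) ≡ true
==-refl zero    = refl
==-refl (suc x) = ==-refl x

==⇒≡ : (x y : Fin n) → (x == y) ≡ true → x ≡ y
==⇒≡ zero    zero    _  = refl
==⇒≡ (suc x) (suc y) eq = cong suc (==⇒≡ x y eq)

≢⇒==-false : (x y : Fin n) → x ≢ y → (x == y) ≡ false
≢⇒==-false x y x≢y with x == y in eq
... | true  = ⊥-elim (x≢y (==⇒≡ x y eq))
... | false = refl

==-false⇒≢ : {x y : Fin n} → (x == y) ≡ false → x ≢ y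
==-false⇒≢ {x = x} x≠y refl with () ← trans (sym x≠y) (==-refl x)

ind : Bool → ℕ
ind b = if b then 1 else 0

ind-∨ : ∀ a b → ind (a ∨ b) ≤ ind a + ind b
ind-∨ true  _ = s≤s z≤n
ind-∨ false _ = ≤-refl

ind-mono : ∀ {a b} → (a ≡ true → b ≡ true) → ind a ≤ ind b
ind-mono {false} _   = z≤n
ind-mono {true}  a⇒b rewrite a⇒b refl = ≤-refl

ind-complement : ∀ b → ind b + ind (not b) ≡ 1
ind-complement true  = refl
ind-complement false = refl

∧-true : ∀ {a b} → (a ∧ b) ≡ true → a ≡ true × b ≡ true
∧-true {true} h = refl , h

∨-weakenʳ : ∀ a b c d → (a ∨ b) ≡ true → ((a ∨ c) ∨ (b ∨ d)) ≡ true
∨-weakenʳ true  _    _ _ _ = refl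
∨-weakenʳ false true c _ _ = ∨-zeroʳ c

∨-weakenˡ : ∀ a b c d → (a ∨ b) ≡ true → ((c ∨ a) ∨ (d ∨ b)) ≡ true
∨-weakenˡ true  _    c _ _ rewrite ∨-zeroʳ c = refl
∨-weakenˡ false true c d _ rewrite ∨-zeroʳ d = ∨-zeroʳ (c ∨ false)

sumFin-cong : {f g : Fin n → ℕ} → (∀ x → f x ≡ g x) → sumFin f ≡ sumFin g
sumFin-cong {zero}  _   = refl
sumFin-cong {suc n} f≗g = cong₂ _+_ (f≗g zero) (sumFin-cong (λ x → f≗g (suc x)))

sumFin-mono : {f g : Fin n → ℕ} → (∀ x → f x ≤ g x) → sumFin f ≤ sumFin g
sumFin-mono {zero}  _   = z≤n
sumFin-mono {suc n} f≤g = +-mono-≤ (f≤g zero) (sumFin-mono (λ x → f≤g (suc x)))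

sumFin-+ : (f g : Fin n → ℕ) → sumFin (λ x → f x + g x) ≡ sumFin f + sumFin g
sumFin-+ {zero}  f g = refl
sumFin-+ {suc n} f g = begin
  f zero + g zero + sumFin (λ x → f (suc x) + g (suc x))
    ≡⟨ cong (f zero + g zero +_) (sumFin-+ (λ x → f (suc x)) (λ x → g (suc x))) ⟩
  f zero + g zero + (sumFin (λ x → f (suc x)) + sumFin (λ x → g (suc x)))
    ≡⟨ interchange (f zero) (g zero) _ _ ⟩
  f zero + sumFin (λ x → f (suc x)) + (g zero + sumFin (λ x → g (suc x))) ∎
  where open ≡-Reasoning

sumFin-zero : sumFin {n} (λ _ → 0) ≡ 0
sumFin-zero {zero}  = refl
sumFin-zero {suc n} = sumFin-zero {n}

sumFin-one : sumFin {n} (λ _ → 1) ≡ n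
sumFin-one {zero}  = refl
sumFin-one {suc n} = cong suc (sumFin-one {n})

sumFin-point : ∀ {n} (a : Fin n) c → sumFin (λ x → if x == a then c else 0) ≡ c
sumFin-point {suc n} zero    c = trans (cong (c +_) (sumFin-zero {n})) (+-identityʳ c)
sumFin-point {suc n} (suc a) c = sumFin-point a c

pair≤sumFin : ∀ {n} (g : Fin n → ℕ) {x y} → x ≢ y → g x + g y ≤ sumFin g
pair≤sumFin g {x} {y} x≢y = begin
  g x + g y
    ≡⟨ cong₂ _+_ (sumFin-point x (g x)) (sumFin-point y (g y)) ⟨
  sumFin (λ z → if z == x then g x else 0) + sumFin (λ z → if z == y then g y else 0)
    ≡⟨ sumFin-+ (λ z → if z == x then g x else 0) (λ z → if z == y then g y else 0) ⟨
  sumFin (λ z → (if z == x then g x else 0) + (if z == y then g y else 0))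
    ≤⟨ sumFin-mono at-most-one ⟩
  sumFin g ∎
  where
  open ≤-Reasoning
  at-most-one : ∀ z → (if z == x then g x else 0) + (if z == y then g y else 0) ≤ g z
  at-most-one z with z == x in z=x | z == y in z=y
  ... | true  | true  = ⊥-elim (x≢y (trans (sym (==⇒≡ z x z=x)) (==⇒≡ z y z=y)))
  ... | true  | false rewrite ==⇒≡ z x z=x = ≤-reflexive (+-identityʳ (g x))
  ... | false | true  rewrite ==⇒≡ z y z=y = ≤-refl
  ... | false | false = z≤n

sumFin-swap : ∀ {m n} (f : Fin m → Fin n → ℕ) →
  sumFin (λ x → sumFin (λ y → f x y)) ≡ sumFin (λ y → sumFin (λ x → f x y))
sumFin-swap {zero}  {n} f = sym (sumFin-zero {n})
sumFin-swap {suc m} {n} f = begin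
  sumFin (f zero) + sumFin (λ x → sumFin (f (suc x)))
    ≡⟨ cong (sumFin (f zero) +_) (sumFin-swap (λ x → f (suc x))) ⟩
  sumFin (f zero) + sumFin (λ y → sumFin (λ x → f (suc x) y))
    ≡⟨ sumFin-+ (f zero) (λ y → sumFin (λ x → f (suc x) y)) ⟨
  sumFin (λ y → f zero y + sumFin (λ x → f (suc x) y)) ∎
  where open ≡-Reasoning

m+m≤n+n⇒m≤n : ∀ {m n} → m + m ≤ n + n → m ≤ n
m+m≤n+n⇒m≤n m+m≤n+n = ≮⇒≥ (λ n<m → <⇒≱ (+-mono-< n<m n<m) m+m≤n+n)

count≡sumFin : (p : Fin n → Bool) → count p ≡ sumFin (λ x → ind (p x))
count≡sumFin {zero}  p = refl
count≡sumFin {suc n} p = cong (ind (p zero) +_) (count≡sumFin (λ x → p (suc x)))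

count-cong : {p q : Fin n → Bool} → (∀ x → p x ≡ q x) → count p ≡ count q
count-cong {zero}  _   = refl
count-cong {suc n} p≗q = cong₂ _+_ (cong ind (p≗q zero)) (count-cong (λ x → p≗q (suc x)))

count-mono : {p q : Fin n → Bool} → (∀ x → p x ≡ true → q x ≡ true) → count p ≤ count q
count-mono {zero}  _   = z≤n
count-mono {suc n} {p} {q} p⇒q =
  +-mono-≤ (ind-mono (p⇒q zero)) (count-mono (λ x → p⇒q (suc x)))

count-∨ : (p q : Fin n → Bool) → count (λ x → p x ∨ q x) ≤ count p + count q
count-∨ {zero}  p q = z≤n
count-∨ {suc n} p q = ≤-trans
  (+-mono-≤ (ind-∨ (p zero) (q zero)) (count-∨ (λ x → p (suc x)) (λ x → q (suc x))))
  (≤-reflexive (interchange (ind (p zero)) (ind (q zero)) _ _))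

count-complement : (p : Fin n → Bool) → count p + count (λ x → not (p x)) ≡ n
count-complement {zero}  p = refl
count-complement {suc n} p = begin
  ind (p zero) + count (λ x → p (suc x)) + (ind (not (p zero)) + count (λ x → not (p (suc x))))
    ≡⟨ interchange (ind (p zero)) _ _ _ ⟩
  ind (p zero) + ind (not (p zero)) + (count (λ x → p (suc x)) + count (λ x → not (p (suc x))))
    ≡⟨ cong₂ _+_ (ind-complement (p zero)) (count-complement (λ x → p (suc x))) ⟩
  suc n ∎
  where open ≡-Reasoning

count-false : count {n} (λ _ → false) ≡ 0
count-false {zero}  = refl
count-false {suc n} = count-false {n}

count-== : (u : Fin n) → count (_== u) ≡ 1
count-== {suc n} zero    = cong suc (count-false {n})
count-== {suc n} (suc u) = count-== u

count-remove : (p : Fin n → Bool) (b : Fin n) →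
  count p ≡ ind (p b) + count (λ x → p x ∧ not (x == b))
count-remove {suc n} p zero rewrite ∧-zeroʳ (p zero) =
  cong (ind (p zero) +_) (count-cong {n} (λ x → sym (∧-identityʳ (p (suc x)))))
count-remove {suc n} p (suc b)
  rewrite count-remove (λ x → p (suc x)) b | ∧-identityʳ (p zero) =
  x∙yz≈y∙xz (ind (p zero)) (ind (p (suc b))) _

count-witness : (p : Fin n → Bool) → 1 ≤ count p → ∃ λ x → p x ≡ true
count-witness {suc n} p 1≤c with p zero in eq
... | true  = zero , eq
... | false with count-witness (λ x → p (suc x)) 1≤c
...   | x , px = suc x , px

length≤count : (p : Fin n → Bool) {xs : List (Fin n)} →
  Unique xs → All (λ x → p x ≡ true) xs → length xs ≤ count p
length≤count p [] [] = z≤n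
length≤count {n} p {a ∷ xs} (a≢xs ∷ u) (pa ∷ pxs) = begin
  suc (length xs)              ≤⟨ s≤s (length≤count q u (All.zipWith q-holds (a≢xs , pxs))) ⟩
  suc (count q)                ≡⟨ cong (_+ count q) (cong ind pa) ⟨
  ind (p a) + count q          ≡⟨ count-remove p a ⟨
  count p                      ∎
  where
  open ≤-Reasoning
  q : Fin n → Bool
  q x = p x ∧ not (x == a)
  q-holds : ∀ {x} → a ≢ x × p x ≡ true → q x ≡ true
  q-holds {x} (a≢x , px) rewrite px | ≢⇒==-false x a (λ x≡a → a≢x (sym x≡a)) = refl

-- Handshake lemma, edge deletion and edge covers

adj⇒≢ : ∀ {n} (G : Graph n) {x y} → adj G x y ≡ true → x ≢ y
adj⇒≢ G {x} xy refl with () ← trans (sym xy) (irrefl G x)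

adj-sym : ∀ {n} (G : Graph n) {x y b} → adj G x y ≡ b → adj G y x ≡ b
adj-sym G {x} {y} xy = trans (Graph.sym G y x) xy

<ᵇ-split : ∀ i j → i ≢ j → ind (i <ᵇ j) + ind (j <ᵇ i) ≡ 1
<ᵇ-split zero    zero    i≢j = ⊥-elim (i≢j refl)
<ᵇ-split zero    (suc j) _   = refl
<ᵇ-split (suc i) zero    _   = refl
<ᵇ-split (suc i) (suc j) i≢j = <ᵇ-split i j (λ i≡j → i≢j (cong suc i≡j))

allEdges : ∀ {n} (G : Graph n) → EdgeSubset G
allEdges G = record { del = adj G ; delSym = Graph.sym G ; delSub = λ _ _ x~y → x~y }

module _ {n} {G : Graph n} (E : EdgeSubset G) where

  handshake : sumFin (λ x → count (del E x)) ≡ edgeCount E + edgeCount E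
  handshake = begin
    sumFin (λ x → count (del E x))
      ≡⟨ sumFin-cong (λ x → count≡sumFin (del E x)) ⟩
    sumFin (λ x → sumFin (λ y → ind (del E x y)))
      ≡⟨ sumFin-cong (λ x → sumFin-cong (split x)) ⟨
    sumFin (λ x → sumFin (λ y → below x y + above x y))
      ≡⟨ sumFin-cong (λ x → sumFin-+ (below x) (above x)) ⟩
    sumFin (λ x → sumFin (below x) + sumFin (above x))
      ≡⟨ sumFin-+ (λ x → sumFin (below x)) (λ x → sumFin (above x)) ⟩
    sumFin (λ x → sumFin (below x)) + sumFin (λ x → sumFin (above x))
      ≡⟨ cong₂ _+_ (sumFin-cong (λ x → sym (count≡sumFin (upper x)))) (sumFin-swap above) ⟩
    edgeCount E + sumFin (λ y → sumFin (λ x → above x y))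
      ≡⟨ cong (edgeCount E +_) (sumFin-cong (λ y → trans (sumFin-cong (flip y)) (sym (count≡sumFin (upper y))))) ⟩
    edgeCount E + edgeCount E ∎
    where
    open ≡-Reasoning
    upper : Fin n → Fin n → Bool
    upper x y = del E x y ∧ (toℕ x <ᵇ toℕ y)
    below above : Fin n → Fin n → ℕ
    below x y = ind (upper x y)
    above x y = ind (del E x y ∧ (toℕ y <ᵇ toℕ x))
    flip : ∀ y x → above x y ≡ below y x
    flip y x = cong (λ b → ind (b ∧ (toℕ y <ᵇ toℕ x))) (delSym E x y)
    split : ∀ x y → below x y + above x y ≡ ind (del E x y)
    split x y with del E x y in eq
    ... | false = refl
    ... | true  = <ᵇ-split (toℕ x) (toℕ y) (adj⇒≢ G (delSub E x y eq) ∘ toℕ-injective)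

  deg-deleteEdges≤ : ∀ x → deg (deleteEdges G E) x ≤ deg G x
  deg-deleteEdges≤ x = count-mono {p = adj (deleteEdges G E) x} (λ y → proj₁ ∘ ∧-true {adj G x y})

  deg≤deg-deleteEdges+del : ∀ x → deg G x ≤ deg (deleteEdges G E) x + count (del E x)
  deg≤deg-deleteEdges+del x = ≤-trans (count-mono {p = adj G x} kept-or-deleted) (count-∨ _ (del E x))
    where
    kept-or-deleted : ∀ y → adj G x y ≡ true → ((adj G x y ∧ not (del E x y)) ∨ del E x y) ≡ true
    kept-or-deleted y xy rewrite xy with del E x y
    ... | true  = refl
    ... | false = refl

  deg-deleteEdges< : ∀ {x y} → del E x y ≡ true → deg (deleteEdges G E) x < deg G x
  deg-deleteEdges< {x} {y} xy = begin
    suc (deg (deleteEdges G E) x)         ≤⟨ s≤s (count-mono {p = adj (deleteEdges G E) x} kept≢y) ⟩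
    suc (count others)                    ≡⟨ cong (λ b → ind b + count others) (delSub E x y xy) ⟨
    ind (adj G x y) + count others        ≡⟨ count-remove (adj G x) y ⟨
    deg G x                               ∎
    where
    open ≤-Reasoning
    others : Fin n → Bool
    others z = adj G x z ∧ not (z == y)
    kept≢y : ∀ z → (adj G x z ∧ not (del E x z)) ≡ true → (adj G x z ∧ not (z == y)) ≡ true
    kept≢y z h with ∧-true {adj G x z} h | z == y in z=y
    ... | xz , kept | false rewrite xz = refl
    ... | xz , kept | true  rewrite ==⇒≡ z y z=y | xy with () ← kept

-- The edges of the cover are the pairs {x, y} with arcs x y ≡ true; an edge listed
-- in both directions is counted twice by size, so size bounds the number of edges.
record EdgeCover {n} (G : Graph n) (S : Pred (Fin n) 0ℓ) (k : ℕ) : Set where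
  field
    arcs     : Fin n → Fin n → Bool
    arcs⊆adj : ∀ x y → arcs x y ≡ true → adj G x y ≡ true
    size     : sumFin (λ x → count (arcs x)) ≤ k
    meets    : ∀ {x} → S x → ∃ λ y → (arcs x y ∨ arcs y x) ≡ true

module _ {n} {G : Graph n} where

  open EdgeCover

  edgesOf : ∀ {S k} → EdgeCover G S k → EdgeSubset G
  edgesOf c = record
    { del    = λ x y → arcs c x y ∨ arcs c y x
    ; delSym = λ x y → ∨-comm (arcs c x y) (arcs c y x)
    ; delSub = sub
    }
    where
    sub : ∀ x y → (arcs c x y ∨ arcs c y x) ≡ true → adj G x y ≡ true
    sub x y h with arcs c x y in xy
    ... | true  = arcs⊆adj c x y xy
    ... | false = adj-sym G (arcs⊆adj c y x h)

  edgeCount-edgesOf : ∀ {S k} (c : EdgeCover G S k) → edgeCount (edgesOf c) ≤ k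
  edgeCount-edgesOf c = ≤-trans (m+m≤n+n⇒m≤n (begin
    edgeCount (edgesOf c) + edgeCount (edgesOf c)
      ≡⟨ handshake (edgesOf c) ⟨
    sumFin (λ x → count (λ y → arcs c x y ∨ arcs c y x))
      ≤⟨ sumFin-mono (λ x → count-∨ (arcs c x) (λ y → arcs c y x)) ⟩
    sumFin (λ x → count (arcs c x) + count (λ y → arcs c y x))
      ≡⟨ sumFin-+ (λ x → count (arcs c x)) (λ x → count (λ y → arcs c y x)) ⟩
    sumFin (λ x → count (arcs c x)) + sumFin (λ x → count (λ y → arcs c y x))
      ≡⟨ cong (sumFin (λ x → count (arcs c x)) +_) reversed ⟩
    sumFin (λ x → count (arcs c x)) + sumFin (λ x → count (arcs c x)) ∎))
    (size c)
    where
    open ≤-Reasoning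
    reversed : sumFin (λ x → count (λ y → arcs c y x)) ≡ sumFin (λ x → count (arcs c x))
    reversed = begin-equality
      sumFin (λ x → count (λ y → arcs c y x))
        ≡⟨ sumFin-cong (λ x → count≡sumFin (λ y → arcs c y x)) ⟩
      sumFin (λ x → sumFin (λ y → ind (arcs c y x)))
        ≡⟨ sumFin-swap (λ x y → ind (arcs c y x)) ⟩
      sumFin (λ y → sumFin (λ x → ind (arcs c y x)))
        ≡⟨ sumFin-cong (λ y → count≡sumFin (arcs c y)) ⟨
      sumFin (λ y → count (arcs c y)) ∎

  noEdges : EdgeCover G (λ _ → ⊥) 0
  noEdges = record
    { arcs     = λ _ _ → false
    ; arcs⊆adj = λ _ _ ()
    ; size     = ≤-reflexive (trans (sumFin-cong {n} (λ _ → count-false {n})) (sumFin-zero {n}))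
    ; meets    = λ ()
    }

  fan : (a : Fin n) (r : Fin n → Bool) → (∀ y → r y ≡ true → adj G a y ≡ true) →
    EdgeCover G (λ x → r x ≡ true ⊎ (x ≡ a × ∃ λ y → r y ≡ true)) (count r)
  fan a r a~r = record
    { arcs     = λ x y → (x == a) ∧ r y
    ; arcs⊆adj = sub
    ; size     = ≤-reflexive (trans (sumFin-cong row) (sumFin-point a (count r)))
    ; meets    = meet
    }
    where
    sub : ∀ x y → ((x == a) ∧ r y) ≡ true → adj G x y ≡ true
    sub x y h with ∧-true {x == a} h
    ... | x=a , ry rewrite ==⇒≡ x a x=a = a~r y ry
    row : ∀ x → count (λ y → (x == a) ∧ r y) ≡ (if x == a then count r else 0)
    row x with x == a
    ... | true  = refl
    ... | false = count-false {n}
    meet : ∀ {x} → r x ≡ true ⊎ (x ≡ a × ∃ λ y → r y ≡ true) →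
      ∃ λ y → (((x == a) ∧ r y) ∨ ((y == a) ∧ r x)) ≡ true
    meet {x} (inj₁ rx) = a , (begin
      ((x == a) ∧ r a) ∨ ((a == a) ∧ r x) ≡⟨ cong₂ (λ b c → ((x == a) ∧ r a) ∨ (b ∧ c)) (==-refl a) rx ⟩
      ((x == a) ∧ r a) ∨ true              ≡⟨ ∨-zeroʳ _ ⟩
      true                                 ∎)
      where open ≡-Reasoning
    meet (inj₂ (refl , y , ry)) = y , cong₂ (λ b c → (b ∧ c) ∨ ((y == a) ∧ r a)) (==-refl a) ry

  _∪ᶜ_ : ∀ {S T k l} → EdgeCover G S k → EdgeCover G T l → EdgeCover G (S ∪ T) (k + l)
  _∪ᶜ_ {S} {T} c d = record
    { arcs     = λ x y → arcs c x y ∨ arcs d x y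
    ; arcs⊆adj = sub
    ; size     = ≤-trans (sumFin-mono (λ x → count-∨ (arcs c x) (arcs d x)))
                   (≤-trans (≤-reflexive (sumFin-+ (λ x → count (arcs c x)) (λ x → count (arcs d x))))
                     (+-mono-≤ (size c) (size d)))
    ; meets    = meet
    }
    where
    sub : ∀ x y → (arcs c x y ∨ arcs d x y) ≡ true → adj G x y ≡ true
    sub x y h with arcs c x y in xy
    ... | true  = arcs⊆adj c x y xy
    ... | false = arcs⊆adj d x y h
    meet : ∀ {x} → (S ∪ T) x → ∃ λ y → ((arcs c x y ∨ arcs d x y) ∨ (arcs c y x ∨ arcs d y x)) ≡ true
    meet {x} (inj₁ s) with y , h ← meets c s =
      y , ∨-weakenʳ (arcs c x y) (arcs c y x) (arcs d x y) (arcs d y x) h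
    meet {x} (inj₂ t) with y , h ← meets d t =
      y , ∨-weakenˡ (arcs d x y) (arcs d y x) (arcs c x y) (arcs c y x) h

  weaken : ∀ {S T k l} → S ⊆ T → k ≤ l → EdgeCover G T k → EdgeCover G S l
  weaken S⊆T k≤l c = record
    { arcs = arcs c ; arcs⊆adj = arcs⊆adj c ; size = ≤-trans (size c) k≤l ; meets = meets c ∘ S⊆T }

edge : ∀ {n} {G : Graph n} {a b} → adj G a b ≡ true → EdgeCover G (λ x → x ≡ a ⊎ x ≡ b) 1
edge {G = G} {a} {b} a~b = weaken endpoints (≤-reflexive (count-== b)) (fan a (_== b) a~b′)
  where
  a~b′ : ∀ y → (y == b) ≡ true → adj G a y ≡ true
  a~b′ y y=b rewrite ==⇒≡ y b y=b = a~b
  endpoints : ∀ {x} → x ≡ a ⊎ x ≡ b → (x == b) ≡ true ⊎ (x ≡ a × ∃ λ y → (y == b) ≡ true)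
  endpoints (inj₁ refl) = inj₂ (refl , b , ==-refl b)
  endpoints (inj₂ refl) = inj₁ (==-refl b)

-- Roman dominating functions

module _ {n} (H : Graph n) where

  -- The weights of the Roman dominating function that puts 2 on u, 0 on its
  -- neighbours and 1 elsewhere.
  starWeight : Fin n → Fin n → ℕ
  starWeight u x = ind (not (adj H u x)) + ind (x == u)

  deg+starWeight : ∀ u → deg H u + sumFin (starWeight u) ≡ suc n
  deg+starWeight u = begin
    deg H u + sumFin (starWeight u)
      ≡⟨ cong (deg H u +_) (sumFin-+ (λ x → ind (not (adj H u x))) (λ x → ind (x == u))) ⟩
    deg H u + (sumFin (λ x → ind (not (adj H u x))) + sumFin (λ x → ind (x == u)))
      ≡⟨ cong₂ (λ a b → deg H u + (a + b)) (count≡sumFin (λ x → not (adj H u x))) (sym (sumFin-point u 1)) ⟨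
    deg H u + (count (λ x → not (adj H u x)) + 1)
      ≡⟨ +-assoc (deg H u) _ 1 ⟨
    deg H u + count (λ x → not (adj H u x)) + 1
      ≡⟨ cong (_+ 1) (count-complement (adj H u)) ⟩
    n + 1
      ≡⟨ +-comm n 1 ⟩
    suc n ∎
    where open ≡-Reasoning

  starRDF : ∀ u → ∃ λ f → IsRDF H f × deg H u + weight f ≡ suc n
  starRDF u = f , dominated , trans (cong (deg H u +_) (sumFin-cong f≡starWeight)) (deg+starWeight u)
    where
    rest f : Fin n → Fin 3
    rest x = if adj H u x then 0F else 1F
    f x = if x == u then 2F else rest x
    f≡starWeight : ∀ x → toℕ (f x) ≡ starWeight u x
    f≡starWeight x with x == u in x=u
    ... | true rewrite ==⇒≡ x u x=u | irrefl H u = refl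
    ... | false with adj H u x
    ...   | true  = refl
    ...   | false = refl
    dominated : IsRDF H f
    dominated v fv≡0 with v == u | adj H u v in uv
    ... | false | true = u , adj-sym H uv , cong (λ b → toℕ (if b then 2F else rest u)) (==-refl u)
    ... | false | false with () ← fv≡0
    ... | true  | _     with () ← fv≡0

  weight-no-2 : ∀ {f} → IsRDF H f → (∀ x → toℕ (f x) ≢ 2) → n ≤ weight f
  weight-no-2 {f} dom no-2 = ≤-trans (≤-reflexive (sym (sumFin-one {n}))) (sumFin-mono positive)
    where
    positive : ∀ x → 1 ≤ toℕ (f x)
    positive x with toℕ (f x) in fx
    ... | zero  with _ , _ , fy ← dom x fx = ⊥-elim (no-2 _ fy)
    ... | suc _ = s≤s z≤n

  weight-unique-2 : ∀ {f u} → IsRDF H f → toℕ (f u) ≡ 2 → (∀ y → toℕ (f y) ≡ 2 → y ≡ u) →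
    suc n ≤ deg H u + weight f
  weight-unique-2 {f} {u} dom fu unique = begin
    suc n                            ≡⟨ deg+starWeight u ⟨
    deg H u + sumFin (starWeight u)  ≤⟨ +-monoʳ-≤ (deg H u) (sumFin-mono starWeight≤f) ⟩
    deg H u + weight f               ∎
    where
    open ≤-Reasoning
    starWeight≤f : ∀ x → starWeight u x ≤ toℕ (f x)
    starWeight≤f x with x == u in x=u
    ... | true rewrite ==⇒≡ x u x=u | irrefl H u | fu = ≤-refl
    ... | false with adj H u x in ux
    ...   | true  = z≤n
    ...   | false with toℕ (f x) in fx
    ...     | suc _ = s≤s z≤n
    ...     | zero  with y , xy , fy ← dom x fx with refl ← unique y fy
                    with () ← trans (sym ux) (adj-sym H xy)

  -- Under 3 + deg ≤ n no vertex can carry the only 2 of a light function,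
  -- two 2s already weigh 4, and a function without 2s weighs at least n.
  weight≥4 : 4 ≤ n → (∀ x → 3 + deg H x ≤ n) → ∀ {f} → IsRDF H f → 4 ≤ weight f
  weight≥4 4≤n small-deg {f} dom with any? (λ u → toℕ (f u) Nat.≟ 2)
  ... | no no-2 = ≤-trans 4≤n (weight-no-2 dom (λ x fx → no-2 (x , fx)))
  ... | yes (u , fu) with any? (λ y → ¬? (y Fin.≟ u) ×-dec (toℕ (f y) Nat.≟ 2))
  ...   | yes (y , y≢u , fy) = ≤-trans (≤-reflexive (sym (cong₂ _+_ fy fu))) (pair≤sumFin (toℕ ∘ f) y≢u)
  ...   | no other-2 = +-cancelˡ-≤ (deg H u) 4 (weight f) (begin
    deg H u + 4     ≡⟨ +-comm (deg H u) 4 ⟩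
    suc (3 + deg H u) ≤⟨ s≤s (small-deg u) ⟩
    suc n           ≤⟨ weight-unique-2 dom fu unique ⟩
    deg H u + weight f ∎)
    where
    open ≤-Reasoning
    unique : ∀ y → toℕ (f y) ≡ 2 → y ≡ u
    unique y fy = decidable-stable (y Fin.≟ u) (λ y≢u → other-2 (y , y≢u , fy))

  isRDF? : ∀ f → Dec (IsRDF H f)
  isRDF? f = all? (λ v → (toℕ (f v) Nat.≟ 0) →-dec
                         any? (λ u → (adj H v u Bool.≟ true) ×-dec (toℕ (f u) Nat.≟ 2)))

  isRDF-cong : ∀ {f g} → (∀ x → f x ≡ g x) → IsRDF H f → IsRDF H g
  isRDF-cong f≗g dom v gv with u , vu , fu ← dom v (trans (cong toℕ (f≗g v)) gv) =
    u , vu , trans (cong toℕ (sym (f≗g u))) fu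

  weight-cong : ∀ {f g : Fin n → Fin 3} → (∀ x → f x ≡ g x) → weight f ≡ weight g
  weight-cong f≗g = sumFin-cong (cong toℕ ∘ f≗g)

  -- The functions Fin n → Fin 3 are searched through their codes in Fin (3 ^ n).
  rdfOfWeight? : ∀ k → Dec (∃ λ f → IsRDF H f × weight f ≡ k)
  rdfOfWeight? k = map′
    (λ (i , dom , w) → finToFun i , dom , w)
    (λ (f , dom , w) → funToFin f , isRDF-cong (sym ∘ finToFun-funToFin f) dom
                                  , trans (weight-cong (finToFun-funToFin f)) w)
    (any? (λ i → isRDF? (finToFun {3} {n} i) ×-dec (weight (finToFun {3} {n} i) Nat.≟ k)))

Least : (ℕ → Set) → Set
Least P = ∃ λ k → P k × (∀ {j} → P j → k ≤ j)

least : ∀ {P : ℕ → Set} → (∀ k → Dec (P k)) → ∀ {m} → P m → Least P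
least {P} P? {m} = <-rec (λ m → P m → Least P) descend m
  where
  descend : ∀ m → (∀ {j} → j < m → P j → Least P) → P m → Least P
  descend m smaller Pm with anyUpTo? P? m
  ... | yes (j , j<m , Pj) = smaller j<m Pj
  ... | no none = m , Pm , λ {j} Pj → ≮⇒≥ (λ j<m → none (j , j<m , Pj))

romanDomNumber-exists : ∀ {n} (H : Graph n) → ∃ (RomanDomNumber H)
romanDomNumber-exists {n} H = minimum (least (rdfOfWeight? H) all-ones)
  where
  minimum : Least (λ k → ∃ λ f → IsRDF H f × weight f ≡ k) → ∃ (RomanDomNumber H)
  minimum (k , rdf , minimal) = k , rdf , λ g dom → minimal (g , dom , refl)
  all-ones : ∃ λ f → IsRDF H f × weight f ≡ n
  all-ones = (λ _ → suc zero) , (λ _ ()) , sumFin-one {n}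

romanDomNumber-unique : ∀ {n} {H : Graph n} {k l} → RomanDomNumber H k → RomanDomNumber H l → k ≡ l
romanDomNumber-unique ((f , dom , refl) , min-k) ((g , dom′ , refl) , min-l) =
  ≤-antisym (min-k g dom′) (min-l f dom)

-- Near-universal vertices and Roman domination number three

Increases : ∀ {n} (G : Graph n) → EdgeSubset G → Set
Increases G E = ∃ λ g → ∃ λ g′ →
  RomanDomNumber G g × RomanDomNumber (deleteEdges G E) g′ × g < g′

NearUniversal : ∀ {n} → Graph n → Fin n → Set
NearUniversal {n} G x = 2 + deg G x ≡ n

module _ {n} (H : Graph n) where

  romanDomNumber+deg≤ : ∀ {k} → RomanDomNumber H k → ∀ x → k + deg H x ≤ suc n
  romanDomNumber+deg≤ {k} (_ , minimal) x with f , dom , deg+w ← starRDF H x = begin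
    k + deg H x         ≤⟨ +-monoˡ-≤ (deg H x) (minimal f dom) ⟩
    weight f + deg H x  ≡⟨ +-comm (weight f) (deg H x) ⟩
    deg H x + weight f  ≡⟨ deg+w ⟩
    suc n               ∎
    where open ≤-Reasoning

  romanDomNumber≥4 : 4 ≤ n → (∀ x → 3 + deg H x ≤ n) → ∀ {k} → RomanDomNumber H k → 4 ≤ k
  romanDomNumber≥4 4≤n small-deg ((f , dom , refl) , _) = weight≥4 H 4≤n small-deg dom

  ¬nearUniversal⇒3+deg≤n : ∀ {x} → 2 + deg H x ≤ n → ¬ NearUniversal H x → 3 + deg H x ≤ n
  ¬nearUniversal⇒3+deg≤n = ≤∧≢⇒<

  nonNeighbours-nearUniversal : ∀ {v} → NearUniversal H v →
    count (λ x → not (adj H v x) ∧ not (x == v)) ≡ 1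
  nonNeighbours-nearUniversal {v} nu = suc-injective (begin
    suc (count (λ x → not (adj H v x) ∧ not (x == v)))
      ≡⟨ cong (λ b → ind (not b) + count (λ x → not (adj H v x) ∧ not (x == v))) (irrefl H v) ⟨
    ind (not (adj H v v)) + count (λ x → not (adj H v x) ∧ not (x == v))
      ≡⟨ count-remove (λ x → not (adj H v x)) v ⟨
    count (λ x → not (adj H v x))
      ≡⟨ +-cancelˡ-≡ (deg H v) _ 2 (trans (count-complement (adj H v)) (trans (sym nu) (+-comm 2 (deg H v)))) ⟩
    2 ∎)
    where open ≡-Reasoning

  nearUniversal⇒nonNeighbour : ∀ {v} → NearUniversal H v → ∃ λ w → w ≢ v × adj H v w ≡ false
  nearUniversal⇒nonNeighbour {v} nu
    with w , h ← count-witness _ (≤-reflexive (sym (nonNeighbours-nearUniversal nu)))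
    with v≁w , w≠v ← ∧-true {not (adj H v w)} h =
    w , ==-false⇒≢ (not-injective w≠v) , not-injective v≁w

  nearUniversal-adj : ∀ {v w x} → NearUniversal H v → w ≢ v → adj H v w ≡ false →
    x ≢ v → x ≢ w → adj H v x ≡ true
  nearUniversal-adj {v} {w} {x} nu w≢v v≁w x≢v x≢w with adj H v x in v~x
  ... | true  = refl
  ... | false = ⊥-elim (1+n≰n (begin
    2                                              ≤⟨ length≤count _ ((x≢w ∷ []) ∷ [] ∷ [])
                                                        (non-neighbour v~x x≢v ∷ non-neighbour v≁w w≢v ∷ []) ⟩
    count (λ y → not (adj H v y) ∧ not (y == v))   ≡⟨ nonNeighbours-nearUniversal nu ⟩
    1                                              ∎))
    where
    open ≤-Reasoning
    non-neighbour : ∀ {y} → adj H v y ≡ false → y ≢ v → (not (adj H v y) ∧ not (y == v)) ≡ true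
    non-neighbour {y} v≁y y≢v rewrite v≁y | ≢⇒==-false y v y≢v = refl

nearUniversal-adj-either : ∀ {n} (G : Graph n) {x y z} → NearUniversal G x →
  y ≢ x → z ≢ x → z ≢ y → adj G x y ≡ true ⊎ adj G x z ≡ true
nearUniversal-adj-either G {x} {y} nu y≢x z≢x z≢y with adj G x y in x~y
... | true  = inj₁ refl
... | false = inj₂ (nearUniversal-adj G nu y≢x x~y z≢x z≢y)

-- Degree sum 5 · 3 = 15 is odd.
nearUniversal-all⇒≢5 : ∀ {n} (G : Graph n) → (∀ x → NearUniversal G x) → n ≢ 5
nearUniversal-all⇒≢5 G all-nu refl = even≢odd e 7 (begin
  2 * e     ≡⟨ cong (e +_) (+-identityʳ e) ⟩
  e + e     ≡⟨ handshake (allEdges G) ⟨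
  sumFin (deg G) ≡⟨ sumFin-cong (λ x → suc-injective (suc-injective (all-nu x))) ⟩
  15        ∎)
  where
  open ≡-Reasoning
  e : ℕ
  e = edgeCount (allEdges G)

module _ {n} (G : Graph n) (γ₃ : RomanDomNumber G 3) where

  2+deg≤n : ∀ x → 2 + deg G x ≤ n
  2+deg≤n x = ≤-pred (romanDomNumber+deg≤ G γ₃ x)

  increases⇒degree-drop : ∀ {E} → Increases G E → ∀ x → 3 + deg (deleteEdges G E) x ≤ n
  increases⇒degree-drop {E} (g , g′ , γ , γ′ , g<g′) x with refl ← romanDomNumber-unique {H = G} γ γ₃ =
    ≤-pred (≤-trans (+-monoˡ-≤ (deg (deleteEdges G E) x) g<g′) (romanDomNumber+deg≤ (deleteEdges G E) γ′ x))

  degree-drop⇒increases : 4 ≤ n → ∀ {E} → (∀ x → 3 + deg (deleteEdges G E) x ≤ n) → Increases G E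
  degree-drop⇒increases 4≤n {E} small-deg with g′ , γ′ ← romanDomNumber-exists (deleteEdges G E) =
    3 , g′ , γ₃ , γ′ , romanDomNumber≥4 (deleteEdges G E) 4≤n small-deg γ′

  cover⇒increases : 4 ≤ n → ∀ {k} (c : EdgeCover G (NearUniversal G) k) → Increases G (edgesOf c)
  cover⇒increases 4≤n c = degree-drop⇒increases 4≤n {edgesOf c} drop
    where
    drop : ∀ x → 3 + deg (deleteEdges G (edgesOf c)) x ≤ n
    drop x with 2 + deg G x Nat.≟ n
    ... | yes nu with y , xy ← EdgeCover.meets c nu =
      ≤-trans (+-monoʳ-≤ 2 (deg-deleteEdges< (edgesOf c) xy)) (2+deg≤n x)
    ... | no ¬nu =
      ≤-trans (+-monoʳ-≤ 3 (deg-deleteEdges≤ (edgesOf c) x)) (¬nearUniversal⇒3+deg≤n G (2+deg≤n x) ¬nu)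

  bondage≤cover : ∀ {b} → RomanBondage G b → 4 ≤ n → ∀ {k} → EdgeCover G (NearUniversal G) k → b ≤ k
  bondage≤cover (_ , minimal) 4≤n c =
    ≤-trans (minimal (edgesOf c) (cover⇒increases 4≤n c)) (edgeCount-edgesOf c)

  maxDegree : 4 ≤ n → MaxDegree G (n ∸ 2)
  maxDegree 4≤n = nearUniversal-exists , λ x → ∸-monoˡ-≤ 2 (2+deg≤n x)
    where
    nearUniversal-exists : ∃ λ v → deg G v ≡ n ∸ 2
    nearUniversal-exists with any? (λ v → 2 + deg G v Nat.≟ n)
    ... | yes (v , nu) = v , cong (_∸ 2) nu
    ... | no none with () ← ≤⇒≯ (romanDomNumber≥4 G 4≤n
                       (λ x → ¬nearUniversal⇒3+deg≤n G (2+deg≤n x) (λ nu → none (x , nu))) γ₃) (s≤s ≤-refl)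

  regular⇒n≤edgeCount+edgeCount : (∀ x → NearUniversal G x) → ∀ {E} → Increases G E →
    n ≤ edgeCount E + edgeCount E
  regular⇒n≤edgeCount+edgeCount all-nu {E} inc = begin
    n                                ≡⟨ sumFin-one {n} ⟨
    sumFin {n} (λ _ → 1)             ≤⟨ sumFin-mono {n} touched ⟩
    sumFin (λ x → count (del E x))   ≡⟨ handshake E ⟩
    edgeCount E + edgeCount E        ∎
    where
    open ≤-Reasoning
    touched : ∀ x → 1 ≤ count (del E x)
    touched x = +-cancelˡ-≤ (2 + deg (deleteEdges G E) x) 1 (count (del E x)) (begin
      2 + deg (deleteEdges G E) x + 1                  ≡⟨ +-comm (2 + deg (deleteEdges G E) x) 1 ⟩
      3 + deg (deleteEdges G E) x                      ≤⟨ increases⇒degree-drop {E} inc x ⟩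
      n                                                ≡⟨ all-nu x ⟨
      2 + deg G x                                      ≤⟨ +-monoʳ-≤ 2 (deg≤deg-deleteEdges+del E x) ⟩
      2 + (deg (deleteEdges G E) x + count (del E x))  ≡⟨ +-assoc 2 (deg (deleteEdges G E) x) (count (del E x)) ⟨
      2 + deg (deleteEdges G E) x + count (del E x)    ∎)

_∈?_ : ∀ {n} (x : Fin n) (xs : List (Fin n)) → Dec (x ∈ xs)
x ∈? xs = Any.any? (x Fin.≟_) xs

unique-lookup-injective : ∀ {A : Set} {xs : List A} → Unique xs → ∀ {i j} → lookup xs i ≡ lookup xs j → i ≡ j
unique-lookup-injective (_ ∷ _)    {zero}  {zero}  _  = refl
unique-lookup-injective (x≢ ∷ _)   {zero}  {suc j} eq = ⊥-elim (All.lookup x≢ (∈-lookup j) eq)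
unique-lookup-injective (x≢ ∷ _)   {suc i} {zero}  eq = ⊥-elim (All.lookup x≢ (∈-lookup i) (sym eq))
unique-lookup-injective (_ ∷ uniq) {suc i} {suc j} eq = cong suc (unique-lookup-injective uniq eq)

fresh : ∀ {n} (xs : List (Fin n)) → length xs < n → ∃ λ x → All (x ≢_) xs
fresh {n} xs len with all? (_∈? xs)
... | yes all∈ = ⊥-elim (<⇒≱ len (injective⇒≤ index-injective))
  where
  index-injective : ∀ {x y} → index (all∈ x) ≡ index (all∈ y) → x ≡ y
  index-injective = MembershipProperties.index-injective (setoid (Fin n)) (all∈ _) (all∈ _)
... | no ¬all∈ with x , x∉ ← ¬∀⟶∃¬ n _ (_∈? xs) ¬all∈ = x , ¬Any⇒All¬ xs x∉

complete : ∀ {n} {xs : List (Fin n)} → Unique xs → length xs ≡ n → ∀ x → x ∈ xs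
complete {xs = xs} uniq len x with x ∈? xs
... | yes x∈ = x∈
... | no x∉ = ⊥-elim (1+n≰n (subst (suc (length xs) ≤_) (sym len)
                      (injective⇒≤ (unique-lookup-injective (¬Any⇒All¬ xs x∉ ∷ uniq)))))

enumeration↔ : ∀ {n} {xs : List (Fin n)} → Unique xs → (∀ x → x ∈ xs) → Fin n ↔ Fin (length xs)
enumeration↔ {xs = xs} uniq all∈ = mk↔ₛ′ (index ∘ all∈) (lookup xs)
  (λ i → unique-lookup-injective uniq (sym (lookup-index (all∈ (lookup xs i)))))
  (λ x → sym (lookup-index (all∈ x)))

-- Order at least five

module LargeOrder {n} (G : Graph n) (5≤n : 5 ≤ n) where

  ShortCover : Set
  ShortCover = ∃ λ k → 3 + k ≤ n × EdgeCover G (NearUniversal G) k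

  3<n : 3 < n
  3<n = <⇒≤ 5≤n
  2<n : 2 < n
  2<n = <⇒≤ 3<n

  module Centred {v w} (v-nu : NearUniversal G v) (w≢v : w ≢ v) (v≁w : adj G v w ≡ false) where

    w-adj : NearUniversal G w → ∀ {x} → x ≢ w → x ≢ v → adj G w x ≡ true
    w-adj w-nu = nearUniversal-adj G w-nu (w≢v ∘ sym) (adj-sym G v≁w)

    starCover : ∀ {T k} (L : List (Fin n)) → Unique L → v ∈ L → w ∈ L → length L < n →
      length L ≡ 3 + k → EdgeCover G T k →
      (∀ {x} → x ∈ L → x ≢ v → NearUniversal G x → T x) → ShortCover
    starCover {T} {k} L uniq v∈L w∈L len<n len c in-T =
      count outside + k , bound , weaken covered ≤-refl (fan v outside v~outside ∪ᶜ c)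
      where
      outside : Fin n → Bool
      outside y = not (does (y ∈? L))
      outside⇒∉ : ∀ {y} → outside y ≡ true → y ∉ L
      outside⇒∉ {y} out y∈L rewrite dec-true (y ∈? L) y∈L with () ← out
      v~outside : ∀ y → outside y ≡ true → adj G v y ≡ true
      v~outside y out = nearUniversal-adj G v-nu w≢v v≁w
        (λ { refl → outside⇒∉ out v∈L }) (λ { refl → outside⇒∉ out w∈L })
      inside : ∀ {y} → y ∈ L → not (outside y) ≡ true
      inside {y} y∈L rewrite not-involutive (does (y ∈? L)) = dec-true (y ∈? L) y∈L
      bound : 3 + (count outside + k) ≤ n
      bound = begin
        3 + (count outside + k)                ≡⟨ x∙yz≈y∙xz 3 (count outside) k ⟩
        count outside + (3 + k)                ≡⟨ cong (count outside +_) len ⟨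
        count outside + length L               ≤⟨ +-monoʳ-≤ (count outside)
                                                    (length≤count _ uniq (All.tabulate inside)) ⟩
        count outside + count (not ∘ outside)  ≡⟨ count-complement outside ⟩
        n                                      ∎
        where open ≤-Reasoning
      fresh-outside : ∃ λ y → outside y ≡ true
      fresh-outside with y , y∉ ← fresh L len<n = y , cong not (dec-false (y ∈? L) (All¬⇒¬Any y∉))
      covered : ∀ {x} → NearUniversal G x →
        (outside x ≡ true ⊎ (x ≡ v × ∃ λ y → outside y ≡ true)) ⊎ T x
      covered {x} nu with x ∈? L
      ... | no _ = inj₁ (inj₁ refl)
      ... | yes x∈L with x Fin.≟ v
      ...   | yes refl = inj₁ (inj₂ (refl , fresh-outside))
      ...   | no x≢v   = inj₂ (in-T x∈L x≢v nu)

    withLowVertex : ∀ {r} → r ≢ v → r ≢ w → ¬ NearUniversal G r → ShortCover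
    withLowVertex {r} r≢v r≢w r-low with 2 + deg G w Nat.≟ n
    ... | no w-low = starCover (r ∷ w ∷ v ∷ []) ((r≢w ∷ r≢v ∷ []) ∷ (w≢v ∷ []) ∷ [] ∷ [])
          (there (there (here refl))) (there (here refl)) 3<n refl noEdges in-T
      where
      in-T : ∀ {x} → x ∈ r ∷ w ∷ v ∷ [] → x ≢ v → NearUniversal G x → ⊥
      in-T (here refl)                 _   nu = r-low nu
      in-T (there (here refl))         _   nu = w-low nu
      in-T (there (there (here refl))) x≢v _  = x≢v refl
    ... | yes w-nu with a , a≢r ∷ a≢w ∷ a≢v ∷ [] ← fresh (r ∷ w ∷ v ∷ []) 3<n =
      starCover (a ∷ r ∷ w ∷ v ∷ [])
        ((a≢r ∷ a≢w ∷ a≢v ∷ []) ∷ (r≢w ∷ r≢v ∷ []) ∷ (w≢v ∷ []) ∷ [] ∷ [])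
        (there (there (there (here refl)))) (there (there (here refl))) 5≤n refl
        (edge (w-adj w-nu a≢w a≢v)) in-T
      where
      in-T : ∀ {x} → x ∈ a ∷ r ∷ w ∷ v ∷ [] → x ≢ v → NearUniversal G x → x ≡ w ⊎ x ≡ a
      in-T (here refl)                         _   _  = inj₂ refl
      in-T (there (here refl))                 _   nu = ⊥-elim (r-low nu)
      in-T (there (there (here refl)))         _   _  = inj₁ refl
      in-T (there (there (there (here refl)))) x≢v _  = ⊥-elim (x≢v refl)

    OutsideEdge : Set
    OutsideEdge = ∃ λ b → ∃ λ c →
      All (b ≢_) (w ∷ v ∷ []) × All (c ≢_) (b ∷ w ∷ v ∷ []) × adj G b c ≡ true

    outsideEdge : (∀ {r} → r ≢ v → r ≢ w → NearUniversal G r) → OutsideEdge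
    outsideEdge outside-nu
      with b , b≢@(b≢w ∷ b≢v ∷ []) ← fresh (w ∷ v ∷ []) 2<n
      with s , s≢b ∷ s≢w ∷ s≢v ∷ [] ← fresh (b ∷ w ∷ v ∷ []) 3<n
      with t , t≢s ∷ t≢b ∷ t≢w ∷ t≢v ∷ [] ← fresh (s ∷ b ∷ w ∷ v ∷ []) 5≤n
      with nearUniversal-adj-either G (outside-nu b≢v b≢w) s≢b t≢b t≢s
    ... | inj₁ b~s = b , s , b≢ , (s≢b ∷ s≢w ∷ s≢v ∷ []) , b~s
    ... | inj₂ b~t = b , t , b≢ , (t≢b ∷ t≢w ∷ t≢v ∷ []) , b~t

    allNearUniversal : (∀ {r} → r ≢ v → r ≢ w → NearUniversal G r) → ShortCover
    allNearUniversal outside-nu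
      with b , c , (b≢w ∷ b≢v ∷ []) , (c≢b ∷ c≢w ∷ c≢v ∷ []) , b~c ← outsideEdge outside-nu
      with 2 + deg G w Nat.≟ n
    ... | no w-low = starCover (c ∷ b ∷ w ∷ v ∷ [])
          ((c≢b ∷ c≢w ∷ c≢v ∷ []) ∷ (b≢w ∷ b≢v ∷ []) ∷ (w≢v ∷ []) ∷ [] ∷ [])
          (there (there (there (here refl)))) (there (there (here refl))) 5≤n refl (edge b~c) in-T
      where
      in-T : ∀ {x} → x ∈ c ∷ b ∷ w ∷ v ∷ [] → x ≢ v → NearUniversal G x → x ≡ b ⊎ x ≡ c
      in-T (here refl)                         _   _  = inj₂ refl
      in-T (there (here refl))                 _   _  = inj₁ refl
      in-T (there (there (here refl)))         _   nu = ⊥-elim (w-low nu)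
      in-T (there (there (there (here refl)))) x≢v _  = ⊥-elim (x≢v refl)
    ... | yes w-nu with m≤n⇒m<n∨m≡n 5≤n
    ...   | inj₂ 5≡n = ⊥-elim (nearUniversal-all⇒≢5 G all-nu (sym 5≡n))
      where
      all-nu : ∀ x → NearUniversal G x
      all-nu x with x Fin.≟ v | x Fin.≟ w
      ... | yes refl | _        = v-nu
      ... | no _     | yes refl = w-nu
      ... | no x≢v   | no x≢w   = outside-nu x≢v x≢w
    ...   | inj₁ 5<n with a , a≢c ∷ a≢b ∷ a≢w ∷ a≢v ∷ [] ← fresh (c ∷ b ∷ w ∷ v ∷ []) 5≤n =
      starCover (a ∷ c ∷ b ∷ w ∷ v ∷ [])
        ((a≢c ∷ a≢b ∷ a≢w ∷ a≢v ∷ []) ∷ (c≢b ∷ c≢w ∷ c≢v ∷ [])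
          ∷ (b≢w ∷ b≢v ∷ []) ∷ (w≢v ∷ []) ∷ [] ∷ [])
        (there (there (there (there (here refl))))) (there (there (there (here refl)))) 5<n refl
        (edge (w-adj w-nu a≢w a≢v) ∪ᶜ edge b~c) in-T
      where
      in-T : ∀ {x} → x ∈ a ∷ c ∷ b ∷ w ∷ v ∷ [] → x ≢ v → NearUniversal G x →
        (x ≡ w ⊎ x ≡ a) ⊎ (x ≡ b ⊎ x ≡ c)
      in-T (here refl)                                 _   _ = inj₁ (inj₂ refl)
      in-T (there (here refl))                         _   _ = inj₂ (inj₂ refl)
      in-T (there (there (here refl)))                 _   _ = inj₂ (inj₁ refl)
      in-T (there (there (there (here refl))))         _   _ = inj₁ (inj₁ refl)
      in-T (there (there (there (there (here refl))))) x≢v _ = ⊥-elim (x≢v refl)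

    cover : ShortCover
    cover with any? (λ r → ¬? (r Fin.≟ v) ×-dec ¬? (r Fin.≟ w) ×-dec ¬? (2 + deg G r Nat.≟ n))
    ... | yes (r , r≢v , r≢w , r-low) = withLowVertex r≢v r≢w r-low
    ... | no none = allNearUniversal (λ {r} r≢v r≢w →
            decidable-stable (2 + deg G r Nat.≟ n) (λ r-low → none (r , r≢v , r≢w , r-low)))

  shortCover : ShortCover
  shortCover with any? (λ v → 2 + deg G v Nat.≟ n)
  ... | no none = 0 , 2<n , weaken (λ {x} nu → none (x , nu)) z≤n noEdges
  ... | yes (v , v-nu) with w , w≢v , v≁w ← nearUniversal⇒nonNeighbour G v-nu =
    Centred.cover v-nu w≢v v≁w

-- Order four

neighbour : ∀ {n} {G : Graph n} → Connected G → ∀ {u v} → u ≢ v → ∃ λ z → adj G u z ≡ true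
neighbour conn {u} {v} u≢v with conn u v
... | here       = ⊥-elim (u≢v refl)
... | step u~z _ = _ , u~z

cycle⇒≅C4 : (G : Graph 4) {a b c d : Fin 4} → Unique (a ∷ b ∷ c ∷ d ∷ []) →
  adj G a b ≡ true → adj G b c ≡ true → adj G c d ≡ true → adj G d a ≡ true →
  adj G a c ≡ false → adj G b d ≡ false → G ≅ C4
cycle⇒≅C4 G {a} {b} {c} {d} uniq ab bc cd da ac bd = σ , preserves
  where
  vs : List (Fin 4)
  vs = a ∷ b ∷ c ∷ d ∷ []
  σ : Fin 4 ↔ Fin 4
  σ = enumeration↔ uniq (complete uniq refl)
  table : ∀ i j → adj G (lookup vs i) (lookup vs j) ≡ c4adj i j
  table 0F 0F = irrefl G a
  table 0F 1F = ab
  table 0F 2F = ac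
  table 0F 3F = adj-sym G da
  table 1F 0F = adj-sym G ab
  table 1F 1F = irrefl G b
  table 1F 2F = bc
  table 1F 3F = bd
  table 2F 0F = adj-sym G ac
  table 2F 1F = adj-sym G bc
  table 2F 2F = irrefl G c
  table 2F 3F = cd
  table 3F 0F = da
  table 3F 1F = adj-sym G bd
  table 3F 2F = adj-sym G cd
  table 3F 3F = irrefl G d
  preserves : ∀ x y → adj G x y ≡ c4adj (Inverse.to σ x) (Inverse.to σ y)
  preserves x y = trans
    (cong₂ (adj G) (lookup-index (complete uniq refl x)) (lookup-index (complete uniq refl y)))
    (table (Inverse.to σ x) (Inverse.to σ y))

module OrderFour (G : Graph 4) (conn : Connected G) (2+deg≤4 : ∀ x → 2 + deg G x ≤ 4) where

  module Centred {v w} (v-nu : NearUniversal G v) (w≢v : w ≢ v) (v≁w : adj G v w ≡ false) where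

    v-adj : ∀ {x} → x ≢ v → x ≢ w → adj G v x ≡ true
    v-adj = nearUniversal-adj G v-nu w≢v v≁w

    module Path {p q} (p≢w : p ≢ w) (p≢v : p ≢ v) (q≢p : q ≢ p) (q≢w : q ≢ w) (q≢v : q ≢ v)
                (w~p : adj G w p ≡ true) where

      vpwq-unique : Unique (v ∷ p ∷ w ∷ q ∷ [])
      vpwq-unique = ((p≢v ∘ sym) ∷ (w≢v ∘ sym) ∷ (q≢v ∘ sym) ∷ [])
                  ∷ (p≢w ∷ (q≢p ∘ sym) ∷ []) ∷ ((q≢w ∘ sym) ∷ []) ∷ [] ∷ []

      p≁q : adj G p q ≡ false
      p≁q with adj G p q in p~q
      ... | false = refl
      ... | true  = ⊥-elim (1+n≰n (≤-trans (+-monoʳ-≤ 2 (length≤count (adj G p)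
              (((w≢v ∘ sym) ∷ (q≢v ∘ sym) ∷ []) ∷ ((q≢w ∘ sym) ∷ []) ∷ [] ∷ [])
              (adj-sym G (v-adj p≢v p≢w) ∷ adj-sym G w~p ∷ p~q ∷ []))) (2+deg≤4 p)))

      pathOrCycle : G ≅ C4 ⊎ EdgeCover G (NearUniversal G) 1
      pathOrCycle with adj G w q in w~q
      ... | true  = inj₁ (cycle⇒≅C4 G vpwq-unique (v-adj p≢v p≢w) (adj-sym G w~p) w~q
                           (adj-sym G (v-adj q≢v q≢w)) v≁w p≁q)
      ... | false = inj₂ (weaken onPath ≤-refl (edge (v-adj p≢v p≢w)))
        where
        onPath : ∀ {x} → NearUniversal G x → x ≡ v ⊎ x ≡ p
        onPath {x} nu with complete vpwq-unique refl x
        ... | here refl                         = inj₁ refl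
        ... | there (here refl)                 = inj₂ refl
        ... | there (there (here refl))
          with nearUniversal-adj-either G nu (w≢v ∘ sym) q≢w q≢v
        ...   | inj₁ w~v with () ← trans (sym w~v) (adj-sym G v≁w)
        ...   | inj₂ w~q′ with () ← trans (sym w~q′) w~q
        onPath {x} nu | there (there (there (here refl)))
          with nearUniversal-adj-either G nu (q≢w ∘ sym) (q≢p ∘ sym) p≢w
        ...   | inj₁ q~w with () ← trans (sym q~w) (adj-sym G w~q)
        ...   | inj₂ q~p with () ← trans (sym q~p) (adj-sym G p≁q)

    classify : G ≅ C4 ⊎ EdgeCover G (NearUniversal G) 1
    classify
      with b , b≢w ∷ b≢v ∷ [] ← fresh (w ∷ v ∷ []) (s≤s (s≤s (s≤s z≤n)))
      with c , c≢b ∷ c≢w ∷ c≢v ∷ [] ← fresh (b ∷ w ∷ v ∷ []) ≤-refl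
      with z , w~z ← neighbour conn w≢v
      with complete ((c≢b ∷ c≢w ∷ c≢v ∷ []) ∷ (b≢w ∷ b≢v ∷ []) ∷ (w≢v ∷ []) ∷ [] ∷ []) refl z
    ... | here refl                         = Path.pathOrCycle c≢w c≢v (c≢b ∘ sym) b≢w b≢v w~z
    ... | there (here refl)                 = Path.pathOrCycle b≢w b≢v c≢b c≢w c≢v w~z
    ... | there (there (here refl))         = ⊥-elim (adj⇒≢ G w~z refl)
    ... | there (there (there (here refl))) with () ← trans (sym w~z) (adj-sym G v≁w)

  classify : G ≅ C4 ⊎ EdgeCover G (NearUniversal G) 1
  classify with any? (λ v → 2 + deg G v Nat.≟ 4)
  ... | no none = inj₂ (weaken (λ {x} nu → none (x , nu)) z≤n noEdges)
  ... | yes (v , v-nu) with w , w≢v , v≁w ← nearUniversal⇒nonNeighbour G v-nu =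
    Centred.classify v-nu w≢v v≁w

c4-neighbours : ∀ i → ∃ λ j → ∃ λ k → j ≢ k × c4adj i j ≡ true × c4adj i k ≡ true
c4-neighbours 0F = 1F , 3F , (λ ()) , refl , refl
c4-neighbours 1F = 0F , 2F , (λ ()) , refl , refl
c4-neighbours 2F = 1F , 3F , (λ ()) , refl , refl
c4-neighbours 3F = 0F , 2F , (λ ()) , refl , refl

module CycleBondage (G : Graph 4) (γ₃ : RomanDomNumber G 3) (σ : G ≅ C4) where

  open Inverse (proj₁ σ) using (to; from; strictlyInverseˡ; strictlyInverseʳ)

  adj-from : ∀ i j → adj G (from i) (from j) ≡ c4adj i j
  adj-from i j = trans (proj₂ σ (from i) (from j)) (cong₂ c4adj (strictlyInverseˡ i) (strictlyInverseˡ j))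

  nearUniversal : ∀ x → NearUniversal G x
  nearUniversal x with j , k , j≢k , ij , ik ← c4-neighbours (to x) =
    ≤-antisym (2+deg≤n G γ₃ x) (+-monoʳ-≤ 2 (length≤count (adj G x)
      (((j≢k ∘ from-injective) ∷ []) ∷ [] ∷ []) (x~from j ij ∷ x~from k ik ∷ [])))
    where
    from-injective : ∀ {i j} → from i ≡ from j → i ≡ j
    from-injective {i} {j} eq = trans (sym (strictlyInverseˡ i)) (trans (cong to eq) (strictlyInverseˡ j))
    x~from : ∀ j → c4adj (to x) j ≡ true → adj G x (from j) ≡ true
    x~from j xj = subst (λ y → adj G y (from j) ≡ true) (strictlyInverseʳ x) (trans (adj-from (to x) j) xj)

  perfectMatching : EdgeCover G (NearUniversal G) 2
  perfectMatching = weaken onMatching ≤-refl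
    (edge (trans (adj-from 0F 1F) refl) ∪ᶜ edge (trans (adj-from 2F 3F) refl))
    where
    onMatching : ∀ {x} → NearUniversal G x → (x ≡ from 0F ⊎ x ≡ from 1F) ⊎ (x ≡ from 2F ⊎ x ≡ from 3F)
    onMatching {x} _ with to x | strictlyInverseʳ x
    ... | 0F | eq = inj₁ (inj₁ (sym eq))
    ... | 1F | eq = inj₁ (inj₂ (sym eq))
    ... | 2F | eq = inj₂ (inj₁ (sym eq))
    ... | 3F | eq = inj₂ (inj₂ (sym eq))

  increases⇒2≤edgeCount : ∀ {E} → Increases G E → 2 ≤ edgeCount E
  increases⇒2≤edgeCount {E} inc = m+m≤n+n⇒m≤n (regular⇒n≤edgeCount+edgeCount G γ₃ nearUniversal {E} inc)

  bondage : RomanBondage G 2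
  bondage = (edgesOf perfectMatching , exactly2 , inc) , λ E → increases⇒2≤edgeCount {E}
    where
    inc : Increases G (edgesOf perfectMatching)
    inc = cover⇒increases G γ₃ ≤-refl perfectMatching
    exactly2 : edgeCount (edgesOf perfectMatching) ≡ 2
    exactly2 = ≤-antisym (edgeCount-edgesOf perfectMatching)
                         (increases⇒2≤edgeCount {edgesOf perfectMatching} inc)

bondage⇒C4 : ∀ {n} {G : Graph n} → 4 ≤ n → Connected G → RomanDomNumber G 3 →
  RomanBondage G (n ∸ 2) → G ≅ C4
bondage⇒C4 {n} {G} 4≤n conn γ₃ bond with m≤n⇒m<n∨m≡n 4≤n
... | inj₂ refl with OrderFour.classify G conn (2+deg≤n G γ₃)
...   | inj₁ σ = σ
...   | inj₂ c = ⊥-elim (1+n≰n (bondage≤cover G γ₃ {2} bond ≤-refl c))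
bondage⇒C4 {n} {G} 4≤n conn γ₃ bond | inj₁ 5≤n
  with k , 3+k≤n , c ← LargeOrder.shortCover G 5≤n = ⊥-elim (≤⇒≯ 3≤2 (s≤s (s≤s (s≤s z≤n))))
  where
  open ≤-Reasoning
  3≤2 : 3 ≤ 2
  3≤2 = +-cancelˡ-≤ (n ∸ 2) 3 2 (begin
    n ∸ 2 + 3    ≡⟨ +-comm (n ∸ 2) 3 ⟩
    3 + (n ∸ 2)  ≤⟨ +-monoʳ-≤ 3 (bondage≤cover G γ₃ {n ∸ 2} bond 4≤n c) ⟩
    3 + k        ≤⟨ 3+k≤n ⟩
    n            ≡⟨ m∸n+n≡m (≤-trans (s≤s (s≤s z≤n)) 4≤n) ⟨
    n ∸ 2 + 2    ∎)

C4⇒bondage : ∀ {n} {G : Graph n} → RomanDomNumber G 3 → G ≅ C4 → RomanBondage G (n ∸ 2)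
C4⇒bondage {G = G} γ₃ σ with refl ← ↔⇒≡ (proj₁ σ) = CycleBondage.bondage G γ₃ σ

theorem13 : ∀ (n : ℕ) (G : Graph n) → 4 ≤ n → Connected G → RomanDomNumber G 3 →
    ((RomanBondage G (n ∸ 2) × MaxDegree G (n ∸ 2)) ⇔ (G ≅ C4))
theorem13 n G 4≤n conn γ₃ = mk⇔
  (λ (bond , _) → bondage⇒C4 4≤n conn γ₃ bond)
  (λ σ → C4⇒bondage γ₃ σ , maxDegree G γ₃ 4≤n)
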